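{- Let $G$ be a finite graph with $|V(G)|\ge 2$. (1) Let $M\in\mathbb{S}(G)$ with $|M|\geq 2$. If some element of $\Pi(G[M])$ is a singleton, then $\{m\in M:\{m\}\in\Pi(G[M])\}\in\mathfrak{S}(G)$. (2) Let $C\in\mathfrak{S}(G)$ with $|C|\geq 2$. Then for every $c\in C$, $C^{\uparrow}=\{c\}^{\Uparrow}$, and $C=\{c\in C^{\uparrow}:\{c\}\in\Pi(G[C^{\uparrow}])\}$. (3) For each $M\in\mathbb{S}(G)$ with $|M|\geq 2$, there is $C\in\mathfrak{S}(G)\cap\mathbb{S}(G)$ such that $|C|\geq 2$ and $C\subseteq M$.
   Context: Graphs are finite, simple, undirected. A module of $G$ is a set $M\subseteq V(G)$ such that each vertex outside $M$ is adjacent to all or none of $M$. A module $M$ is strong if for every module $N$ with $M\cap N\neq\emptyset$, $M\subseteq N$ or $N\subseteq M$. $\mathbb{S}(G)$ is the family of nonempty strong modules of $G$. For a graph $H$ with $|V(H)|\geq 2$, $\Pi(H)$ is the family of maximal elements under inclusion among the proper nonempty strong modules of $H$ (it is a partition of $V(H)$). For $W\subseteq V(G)$, $W^{\uparrow}$ is the smallest strong module of $G$ containing $W$; for $W\subsetneq V(G)$, $W^{\Uparrow}$ is the smallest strong module of $G$ strictly containing $W$ (the strong modules containing, resp. strictly containing, $W$ form a chain under inclusion). The equivalence relation $\leftrightarrow_G$ on $V(G)$ is given by $v\leftrightarrow_G w$ iff $\{v\}^{\Uparrow}=\{w\}^{\Uparrow}$; $\mathfrak{S}(G)$ is the set of its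 equivalence classes. -}

module Defs where

open import Data.Nat using (ℕ; _≤_)
open import Data.Bool using (Bool; true; false)
open import Data.Fin using (Fin)
open import Data.Fin.Subset using (Subset; _∈_; _∉_; _⊆_; _⊂_; ⁅_⁆; ⊤; ∣_∣; Nonempty)
open import Data.Product using (_×_; ∃; Σ)
open import Data.Sum using (_⊎_)
open import Relation.Nullary using (¬_)
open import Relation.Binary.PropositionalEquality using (_≡_)
open import Function.Bundles using (_⇔_)

record Graph : Set where
  field
    n     : ℕ
    adj   : Fin n → Fin n → Bool
    sym   : ∀ u v → adj u v ≡ adj v u
    irrefl : ∀ v → adj v v ≡ false
open Graph public

module _ (G : Graph) where
  private
    V = Fin (n G)

  -- M is a module of the induced subgraph G[U]  (M ⊆ U).
  -- Modules of G itself are modules of G[⊤].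
  IsModuleIn : Subset (n G) → Subset (n G) → Set
  IsModuleIn U M = M ⊆ U ×
    (∀ x → x ∈ U → x ∉ M →
       (∀ m → m ∈ M → adj G x m ≡ true) ⊎ (∀ m → m ∈ M → adj G x m ≡ false))

  IsStrongIn : Subset (n G) → Subset (n G) → Set
  IsStrongIn U M = IsModuleIn U M ×
    (∀ N → IsModuleIn U N → (∃ λ x → x ∈ M × x ∈ N) → M ⊆ N ⊎ N ⊆ M)

  InS : Subset (n G) → Set
  InS M = Nonempty M × IsStrongIn ⊤ M

  ProperNonemptyStrongIn : Subset (n G) → Subset (n G) → Set
  ProperNonemptyStrongIn U P = Nonempty P × ¬ (P ≡ U) × IsStrongIn U P

  InΠ : Subset (n G) → Subset (n G) → Set
  InΠ U P = ProperNonemptyStrongIn U P ×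
    (∀ Q → ProperNonemptyStrongIn U Q → P ⊆ Q → Q ⊆ P)

  IsUp : Subset (n G) → Subset (n G) → Set
  IsUp W S = InS S × W ⊆ S × (∀ S' → InS S' → W ⊆ S' → S ⊆ S')

  IsUpUp : Subset (n G) → Subset (n G) → Set
  IsUpUp W S = InS S × W ⊂ S × (∀ S' → InS S' → W ⊂ S' → S ⊆ S')

  _↔G_ : V → V → Set
  v ↔G w = ∃ λ S → IsUpUp ⁅ v ⁆ S × IsUpUp ⁅ w ⁆ S

  InFrakS : Subset (n G) → Set
  InFrakS C = ∃ λ v → ∀ w → (w ∈ C) ⇔ (v ↔G w)

-- The whole lemma rests on one observation: for a strong module S of G, the
-- singleton {c} is a maximal strong module of G[S] exactly when {c}^⇑ = S.
-- Hence {m ∈ M : {m} ∈ Π(G[M])} is the ↔_G-class of the vertices whose {·}^⇑ is M,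
-- which gives (1) and (2); for (3), a strong module M' ⊆ M with |M'| ≥ 2 that is
-- minimal with these properties satisfies {x}^⇑ = M' for every x ∈ M', so M'
-- itself is a ↔_G-class.
module Submission where

open import Defs
open import Data.Nat using (ℕ; suc; _≤_; _≤?_; s≤s)
open import Data.Nat.Properties using (≤-trans)
open import Data.Bool using (true; false)
open import Data.Bool.Properties using () renaming (_≟_ to _≟ᵇ_)
open import Data.Fin using (Fin)
open import Data.Fin.Properties using (any?; all?)
open import Data.Fin.Subset using (Subset; _∈_; _∉_; _⊆_; _⊂_; ⁅_⁆; ⊤; ∣_∣; Nonempty)
open import Data.Fin.Subset.Properties
  using (_∈?_; _⊆?_; ⊆-antisym; _⊂?_; nonempty?; Empty-unique; ∈⊤; x∈⁅x⁆; x∈⁅y⁆⇒x≡y; ∣⁅x⁆∣≡1; ∣⊥∣≡0;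
         p⊆q⇒∣p∣≤∣q∣; p⊂q⇒∣p∣<∣q∣; ⊂-⊆-trans; anySubset?)
open import Data.Fin.Subset.Induction using (⊂-wellFounded; Acc; acc)
open import Data.Product using (_×_; ∃; _,_; proj₁; proj₂)
open import Data.Sum using (_⊎_; inj₁; inj₂)
open import Data.Empty using (⊥-elim)
open import Relation.Nullary using (¬_; Dec; yes; no)
open import Relation.Nullary.Decidable using (_×-dec_; _⊎-dec_; _→-dec_; ¬?; decidable-stable)
open import Relation.Binary.PropositionalEquality using (_≡_; refl; cong; subst) renaming (sym to ≡-sym)
open import Function.Bundles using (_⇔_; mk⇔; Equivalence)
open import Function.Construct.Composition using (_⇔-∘_)
open import Function.Construct.Symmetry using (⇔-sym)

open Equivalence using (to)

private
  variable
    k : ℕ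
    p : Subset k
    x : Fin k

⊆-or-∈∉ : (p q : Subset k) → p ⊆ q ⊎ ∃ λ x → x ∈ p × x ∉ q
⊆-or-∈∉ p q with any? (λ x → (x ∈? p) ×-dec ¬? (x ∈? q))
... | yes (x , x∈p , x∉q) = inj₂ (x , x∈p , x∉q)
... | no ∄ = inj₁ λ {x} x∈p → decidable-stable (x ∈? q) (λ x∉q → ∄ (x , x∈p , x∉q))

x∈p⇒⁅x⁆⊆p : x ∈ p → ⁅ x ⁆ ⊆ p
x∈p⇒⁅x⁆⊆p {x = x} {p = p} x∈p y∈⁅x⁆ = subst (_∈ p) (≡-sym (x∈⁅y⁆⇒x≡y x y∈⁅x⁆)) x∈p

2≤∣p∣⇒Nonempty : {p : Subset k} → 2 ≤ ∣ p ∣ → Nonempty p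
2≤∣p∣⇒Nonempty {k = k} {p = p} 2≤∣p∣ with nonempty? p
... | yes ne = ne
... | no empty with refl ← Empty-unique empty = ⊥-elim (¬2≤0 (subst (2 ≤_) (∣⊥∣≡0 k) 2≤∣p∣))
  where
  ¬2≤0 : ¬ 2 ≤ 0
  ¬2≤0 ()

2≤∣p∣⇒⁅x⁆⊂p : 2 ≤ ∣ p ∣ → x ∈ p → ⁅ x ⁆ ⊂ p
2≤∣p∣⇒⁅x⁆⊂p {p = p} {x = x} 2≤∣p∣ x∈p with ⊆-or-∈∉ p ⁅ x ⁆
... | inj₂ (y , y∈p , y∉⁅x⁆) = x∈p⇒⁅x⁆⊆p x∈p , y , y∈p , y∉⁅x⁆
... | inj₁ p⊆⁅x⁆ = ⊥-elim (¬2≤1 (≤-trans 2≤∣p∣ (subst (∣ p ∣ ≤_) (∣⁅x⁆∣≡1 x) (p⊆q⇒∣p∣≤∣q∣ p⊆⁅x⁆))))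
  where
  ¬2≤1 : ¬ 2 ≤ 1
  ¬2≤1 (s≤s ())

⁅x⁆⊂p⇒2≤∣p∣ : ⁅ x ⁆ ⊂ p → 2 ≤ ∣ p ∣
⁅x⁆⊂p⇒2≤∣p∣ {x = x} {p = p} ⁅x⁆⊂p = subst (_≤ ∣ p ∣) (cong suc (∣⁅x⁆∣≡1 x)) (p⊂q⇒∣p∣<∣q∣ ⁅x⁆⊂p)

allSubsets? : {P : Subset k → Set} → (∀ p → Dec (P p)) → Dec (∀ p → P p)
allSubsets? {P = P} P? with anySubset? {P = λ p → ¬ P p} (λ p → ¬? (P? p))
... | yes (p , ¬Pp) = no λ ∀P → ¬Pp (∀P p)
... | no ∄ = yes λ p → decidable-stable (P? p) (λ ¬Pp → ∄ (p , ¬Pp))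

module _ (G : Graph) where

  private
    variable
      U M S X : Subset (n G)
      c v w : Fin (n G)

  isModuleIn? : ∀ U M → Dec (IsModuleIn G U M)
  isModuleIn? U M =
    (M ⊆? U) ×-dec all? λ y → (y ∈? U) →-dec (¬? (y ∈? M) →-dec (uniform y true ⊎-dec uniform y false))
    where
    uniform : ∀ y b → Dec (∀ m → m ∈ M → adj G y m ≡ b)
    uniform y b = all? λ m → (m ∈? M) →-dec (adj G y m ≟ᵇ b)

  isStrongIn? : ∀ U M → Dec (IsStrongIn G U M)
  isStrongIn? U M = isModuleIn? U M ×-dec allSubsets? λ N →
    isModuleIn? U N →-dec (any? (λ y → (y ∈? M) ×-dec (y ∈? N)) →-dec ((M ⊆? N) ⊎-dec (N ⊆? M)))

  inS? : ∀ M → Dec (InS G M)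
  inS? M = nonempty? M ×-dec isStrongIn? ⊤ M

  ⁅c⁆-isStrongIn : c ∈ U → IsStrongIn G U ⁅ c ⁆
  ⁅c⁆-isStrongIn {c = c} c∈U = (x∈p⇒⁅x⁆⊆p c∈U , uniform) , comparable
    where
    uniform : ∀ y → y ∈ U → y ∉ ⁅ c ⁆ →
      (∀ m → m ∈ ⁅ c ⁆ → adj G y m ≡ true) ⊎ (∀ m → m ∈ ⁅ c ⁆ → adj G y m ≡ false)
    uniform y _ _ with adj G y c in eq
    ... | true = inj₁ λ m m∈⁅c⁆ → subst (λ z → adj G y z ≡ true) (≡-sym (x∈⁅y⁆⇒x≡y c m∈⁅c⁆)) eq
    ... | false = inj₂ λ m m∈⁅c⁆ → subst (λ z → adj G y z ≡ false) (≡-sym (x∈⁅y⁆⇒x≡y c m∈⁅c⁆)) eq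
    comparable : ∀ N → IsModuleIn G U N → (∃ λ y → y ∈ ⁅ c ⁆ × y ∈ N) → ⁅ c ⁆ ⊆ N ⊎ N ⊆ ⁅ c ⁆
    comparable N _ (y , y∈⁅c⁆ , y∈N) = inj₁ (x∈p⇒⁅x⁆⊆p (subst (_∈ N) (x∈⁅y⁆⇒x≡y c y∈⁅c⁆) y∈N))

  isModuleIn-trans : IsModuleIn G ⊤ M → IsModuleIn G M X → IsModuleIn G ⊤ X
  isModuleIn-trans {M = M} {X = X} (_ , M-uniform) (X⊆M , X-uniform) = (λ _ → ∈⊤) , uniform
    where
    uniform : ∀ y → y ∈ ⊤ → y ∉ X →
      (∀ m → m ∈ X → adj G y m ≡ true) ⊎ (∀ m → m ∈ X → adj G y m ≡ false)
    uniform y _ y∉X with y ∈? M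
    ... | yes y∈M = X-uniform y y∈M y∉X
    ... | no y∉M with M-uniform y ∈⊤ y∉M
    ...   | inj₁ all-true = inj₁ λ m m∈X → all-true m (X⊆M m∈X)
    ...   | inj₂ all-false = inj₂ λ m m∈X → all-false m (X⊆M m∈X)

  isStrongIn-restrict : IsModuleIn G ⊤ M → IsStrongIn G ⊤ X → X ⊆ M → IsStrongIn G M X
  isStrongIn-restrict M-module ((_ , X-uniform) , X-strong) X⊆M =
    (X⊆M , λ y _ → X-uniform y ∈⊤) , λ N N-module → X-strong N (isModuleIn-trans M-module N-module)

  isStrongIn-trans : IsStrongIn G ⊤ M → IsStrongIn G M X → IsStrongIn G ⊤ X
  isStrongIn-trans {X = X} (M-module , M-strong) (X-module@(X⊆M , _) , X-strong) =
    isModuleIn-trans M-module X-module , comparable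
    where
    comparable : ∀ N → IsModuleIn G ⊤ N → (∃ λ y → y ∈ X × y ∈ N) → X ⊆ N ⊎ N ⊆ X
    comparable N N-module@(_ , N-uniform) common@(y , y∈X , y∈N)
      with M-strong N N-module (y , X⊆M y∈X , y∈N)
    ... | inj₁ M⊆N = inj₁ λ z∈X → M⊆N (X⊆M z∈X)
    ... | inj₂ N⊆M = X-strong N (N⊆M , λ z _ → N-uniform z ∈⊤) common

  IsUpUp-unique : IsUpUp G X S → IsUpUp G X M → S ≡ M
  IsUpUp-unique (S-strong , X⊂S , S-least) (M-strong , X⊂M , M-least) =
    ⊆-antisym (S-least _ M-strong X⊂M) (M-least _ S-strong X⊂S)

  IsUpUp⇒∈ : IsUpUp G ⁅ c ⁆ S → c ∈ S
  IsUpUp⇒∈ {c = c} (_ , (⁅c⁆⊆S , _) , _) = ⁅c⁆⊆S (x∈⁅x⁆ c)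

  IsUpUp⇒InΠ : IsUpUp G ⁅ c ⁆ S → InΠ G S ⁅ c ⁆
  IsUpUp⇒InΠ {c = c} {S = S} ((_ , S-isStrong) , (⁅c⁆⊆S , y , y∈S , y∉⁅c⁆) , S-least) =
    ((c , x∈⁅x⁆ c) , ⁅c⁆≢S , isStrongIn-restrict (proj₁ S-isStrong) (⁅c⁆-isStrongIn ∈⊤) ⁅c⁆⊆S) , maximal
    where
    ⁅c⁆≢S : ¬ ⁅ c ⁆ ≡ S
    ⁅c⁆≢S refl = y∉⁅c⁆ y∈S
    maximal : ∀ Q → ProperNonemptyStrongIn G S Q → ⁅ c ⁆ ⊆ Q → Q ⊆ ⁅ c ⁆
    maximal Q (Q-nonempty , Q≢S , Q-strong) ⁅c⁆⊆Q with ⊆-or-∈∉ Q ⁅ c ⁆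
    ... | inj₁ Q⊆⁅c⁆ = Q⊆⁅c⁆
    ... | inj₂ (z , z∈Q , z∉⁅c⁆) = ⊥-elim (Q≢S (⊆-antisym (proj₁ (proj₁ Q-strong))
          (S-least Q (Q-nonempty , isStrongIn-trans S-isStrong Q-strong) (⁅c⁆⊆Q , z , z∈Q , z∉⁅c⁆))))

  -- Overlapping strong modules are nested, so a strong S' ⊅ S strictly containing {c}
  -- would be a proper strong module of G[S] strictly above the maximal {c}.
  InΠ⇒IsUpUp : InS G S → InΠ G S ⁅ c ⁆ → IsUpUp G ⁅ c ⁆ S
  InΠ⇒IsUpUp {S = S} {c = c} S-strong@(_ , S-module , S-isStrong) ((_ , ⁅c⁆≢S , ⁅c⁆-strong) , maximal) =
    S-strong , (⁅c⁆⊆S , outside-⁅c⁆) , least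
    where
    ⁅c⁆⊆S : ⁅ c ⁆ ⊆ S
    ⁅c⁆⊆S = proj₁ (proj₁ ⁅c⁆-strong)
    outside-⁅c⁆ : ∃ λ y → y ∈ S × y ∉ ⁅ c ⁆
    outside-⁅c⁆ with ⊆-or-∈∉ S ⁅ c ⁆
    ... | inj₁ S⊆⁅c⁆ = ⊥-elim (⁅c⁆≢S (⊆-antisym ⁅c⁆⊆S S⊆⁅c⁆))
    ... | inj₂ witness = witness
    least : ∀ S' → InS G S' → ⁅ c ⁆ ⊂ S' → S ⊆ S'
    least S' (S'-nonempty , S'-module , S'-isStrong) (⁅c⁆⊆S' , y , y∈S' , y∉⁅c⁆)
      with S-isStrong S' S'-module (c , ⁅c⁆⊆S (x∈⁅x⁆ c) , ⁅c⁆⊆S' (x∈⁅x⁆ c)) | ⊆-or-∈∉ S S'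
    ... | _ | inj₁ S⊆S' = S⊆S'
    ... | inj₁ S⊆S' | inj₂ _ = S⊆S'
    ... | inj₂ S'⊆S | inj₂ (z , z∈S , z∉S') = ⊥-elim (y∉⁅c⁆ (maximal S'
          (S'-nonempty , (λ { refl → z∉S' z∈S }) , isStrongIn-restrict S-module (S'-module , S'-isStrong) S'⊆S)
          ⁅c⁆⊆S' y∈S'))

  ∈×InΠ⇔IsUpUp : InS G S → (c ∈ S × InΠ G S ⁅ c ⁆) ⇔ IsUpUp G ⁅ c ⁆ S
  ∈×InΠ⇔IsUpUp S-strong = mk⇔ (λ (_ , Π) → InΠ⇒IsUpUp S-strong Π) (λ up → IsUpUp⇒∈ up , IsUpUp⇒InΠ up)

  ↔G⇔IsUpUp : IsUpUp G ⁅ v ⁆ S → _↔G_ G v w ⇔ IsUpUp G ⁅ w ⁆ S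
  ↔G⇔IsUpUp {w = w} v-up = mk⇔
    (λ (S' , v-up' , w-up') → subst (IsUpUp G ⁅ w ⁆) (IsUpUp-unique v-up' v-up) w-up')
    (λ w-up → _ , v-up , w-up)

  IsUpUp-class⇒InFrakS : IsUpUp G ⁅ v ⁆ S → (∀ w → (w ∈ X) ⇔ IsUpUp G ⁅ w ⁆ S) → InFrakS G X
  IsUpUp-class⇒InFrakS v-up X-class = _ , λ w → ⇔-sym (↔G⇔IsUpUp v-up) ⇔-∘ X-class w

  IsUpUp-class⇒IsUp : (∀ w → (w ∈ X) ⇔ IsUpUp G ⁅ w ⁆ S) → 2 ≤ ∣ X ∣ → IsUp G X S
  IsUpUp-class⇒IsUp {X = X} {S = S} X-class 2≤∣X∣ with 2≤∣p∣⇒Nonempty 2≤∣X∣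
  ... | y , y∈X = proj₁ y-up , X⊆S , least
    where
    y-up : IsUpUp G ⁅ y ⁆ S
    y-up = to (X-class y) y∈X
    X⊆S : X ⊆ S
    X⊆S {w} w∈X = IsUpUp⇒∈ (to (X-class w) w∈X)
    least : ∀ S' → InS G S' → X ⊆ S' → S ⊆ S'
    least S' S'-strong X⊆S' = proj₂ (proj₂ y-up) S' S'-strong (⊂-⊆-trans (2≤∣p∣⇒⁅x⁆⊂p 2≤∣X∣ y∈X) X⊆S')

  MinimalNontrivialStrong : Subset (n G) → Set
  MinimalNontrivialStrong M = InS G M × 2 ≤ ∣ M ∣ × (∀ Q → InS G Q → Q ⊂ M → ¬ 2 ≤ ∣ Q ∣)

  minimalNontrivialStrong-⊆ : InS G M → 2 ≤ ∣ M ∣ → ∃ λ M' → M' ⊆ M × MinimalNontrivialStrong M'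
  minimalNontrivialStrong-⊆ {M = M} = go M (⊂-wellFounded M)
    where
    go : ∀ M → Acc _⊂_ M → InS G M → 2 ≤ ∣ M ∣ → ∃ λ M' → M' ⊆ M × MinimalNontrivialStrong M'
    go M (acc smaller) M-strong 2≤∣M∣
      with anySubset? (λ Q → inS? Q ×-dec ((Q ⊂? M) ×-dec (2 ≤? ∣ Q ∣)))
    ... | no ∄ = M , (λ m∈M → m∈M) , M-strong , 2≤∣M∣ , λ Q Q-strong Q⊂M 2≤∣Q∣ → ∄ (Q , Q-strong , Q⊂M , 2≤∣Q∣)
    ... | yes (Q , Q-strong , Q⊂M , 2≤∣Q∣) with go Q (smaller Q⊂M) Q-strong 2≤∣Q∣
    ...   | M' , M'⊆Q , M'-minimal = M' , (λ m∈M' → proj₁ Q⊂M (M'⊆Q m∈M')) , M'-minimal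

  minimalNontrivialStrong⇒IsUpUp : MinimalNontrivialStrong M → c ∈ M → IsUpUp G ⁅ c ⁆ M
  minimalNontrivialStrong⇒IsUpUp {M = M} {c = c} (M-strong@(_ , M-module , _) , 2≤∣M∣ , minimal) c∈M =
    M-strong , 2≤∣p∣⇒⁅x⁆⊂p 2≤∣M∣ c∈M , least
    where
    least : ∀ S' → InS G S' → ⁅ c ⁆ ⊂ S' → M ⊆ S'
    least S' S'-strong@(_ , _ , S'-isStrong) ⁅c⁆⊂S'@(⁅c⁆⊆S' , _)
      with S'-isStrong M M-module (c , ⁅c⁆⊆S' (x∈⁅x⁆ c) , c∈M) | ⊆-or-∈∉ M S'
    ... | _ | inj₁ M⊆S' = M⊆S'
    ... | inj₂ M⊆S' | inj₂ _ = M⊆S'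
    ... | inj₁ S'⊆M | inj₂ (z , z∈M , z∉S') =
      ⊥-elim (minimal S' S'-strong (S'⊆M , z , z∈M , z∉S') (⁅x⁆⊂p⇒2≤∣p∣ ⁅c⁆⊂S'))

  singletonsOfΠ-InFrakS : InS G M → (∃ λ m → m ∈ M × InΠ G M ⁅ m ⁆) →
    (∀ w → (w ∈ X) ⇔ (w ∈ M × InΠ G M ⁅ w ⁆)) → InFrakS G X
  singletonsOfΠ-InFrakS M-strong (_ , _ , m-Π) X-def =
    IsUpUp-class⇒InFrakS (InΠ⇒IsUpUp M-strong m-Π) λ w → ∈×InΠ⇔IsUpUp M-strong ⇔-∘ X-def w

  InFrakS-nontrivial-structure : InFrakS G X → 2 ≤ ∣ X ∣ →
    ∃ λ S → IsUp G X S × (∀ c → c ∈ X → IsUpUp G ⁅ c ⁆ S) × (∀ w → (w ∈ X) ⇔ (w ∈ S × InΠ G S ⁅ w ⁆))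
  InFrakS-nontrivial-structure {X = X} (v , X-def) 2≤∣X∣ with 2≤∣p∣⇒Nonempty 2≤∣X∣
  ... | x , x∈X with to (X-def x) x∈X
  ...   | S , v-up , _ = S , IsUpUp-class⇒IsUp X-class 2≤∣X∣ , (λ c → to (X-class c))
                       , λ w → ⇔-sym (∈×InΠ⇔IsUpUp (proj₁ v-up)) ⇔-∘ X-class w
    where
    X-class : ∀ w → (w ∈ X) ⇔ IsUpUp G ⁅ w ⁆ S
    X-class w = ↔G⇔IsUpUp v-up ⇔-∘ X-def w

  InS-nontrivial⇒∃InFrakS-⊆ : InS G M → 2 ≤ ∣ M ∣ →
    ∃ λ C → InFrakS G C × InS G C × 2 ≤ ∣ C ∣ × C ⊆ M
  InS-nontrivial⇒∃InFrakS-⊆ M-strong 2≤∣M∣ with minimalNontrivialStrong-⊆ M-strong 2≤∣M∣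
  ... | M' , M'⊆M , M'-minimal@(M'-strong , 2≤∣M'∣ , _) with 2≤∣p∣⇒Nonempty 2≤∣M'∣
  ...   | x , x∈M' = M' , IsUpUp-class⇒InFrakS (to (M'-class x) x∈M') M'-class , M'-strong , 2≤∣M'∣ , M'⊆M
    where
    M'-class : ∀ w → (w ∈ M') ⇔ IsUpUp G ⁅ w ⁆ M'
    M'-class w = mk⇔ (minimalNontrivialStrong⇒IsUpUp M'-minimal) IsUpUp⇒∈

lemma15 : (G : Graph) → 2 ≤ n G →
    (∀ M → InS G M → 2 ≤ ∣ M ∣ → (∃ λ m → m ∈ M × InΠ G M ⁅ m ⁆) →
       ∀ C → (∀ x → (x ∈ C) ⇔ (x ∈ M × InΠ G M ⁅ x ⁆)) → InFrakS G C)
  × (∀ C → InFrakS G C → 2 ≤ ∣ C ∣ →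
       ∃ λ S → IsUp G C S
         × (∀ c → c ∈ C → IsUpUp G ⁅ c ⁆ S)
         × (∀ x → (x ∈ C) ⇔ (x ∈ S × InΠ G S ⁅ x ⁆)))
  × (∀ M → InS G M → 2 ≤ ∣ M ∣ →
       ∃ λ C → InFrakS G C × InS G C × 2 ≤ ∣ C ∣ × C ⊆ M)
lemma15 G _ =
  (λ M M-strong _ singleton _ C-def → singletonsOfΠ-InFrakS G M-strong singleton C-def) ,
  (λ C → InFrakS-nontrivial-structure G) ,
  (λ M → InS-nontrivial⇒∃InFrakS-⊆ G)
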